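{- Let $(G,w)$ be a weighted game graph, let $c\ge n$ be an integer and $B=\lfloor c/n\rfloor$. For every node $v$ with penalty $P_{G,w}(v)\ge B$ we have \[ e^*_{G,w_B}(v)\le e^*_{G,w}(v)\le e^*_{G,w_B}(v)+nB\le e^*_{G,w_B}(v)+c. \]
   Context: A weighted game graph $(G,w)$ consists of a finite directed graph $G=(V,E)$ in which every node has out-degree at least $1$, a partition $V=V_A\cup V_B$ into nodes of Alice and of Bob, and integer edge weights $w:E\to\mathbb{Z}$; $n=|V|$. A (positional) strategy $\sigma$ of Alice picks for each $u\in V_A$ an out-neighbor $\sigma(u)$; a strategy $\tau$ of Bob picks for each $u\in V_B$ an out-neighbor $\tau(u)$. $G(\sigma,\tau)$ is the subgraph with edges $\{(u,\sigma(u)):u\in V_A\}\cup\{(u,\tau(u)):u\in V_B\}$; from any node $s$ there is a unique cycle $C$ reachable in it. $w(P)$ is the total weight of a path/cycle $P$. Set $e^*_{G(\sigma,\tau),w}(s)=\infty$ if $w(C)<0$, else $\max\{0,-\min_P w(P)\}$ over simple paths $P$ in $G(\sigma,\tau)$ starting at $s$. The minimal energy is $e^*_{G,w}(s)=\min_\sigma\max_\tau e^*_{G(\sigma,\tau),w}(s)$. A strategy $\tau^*$ of Bob is optimal (for $s$) if $e^*_{G(\sigma,\tau^*),w}(s)\ge e^*_{G,w}(s)$ for all $\sigma$. Node $s$ has penalty at least $D\ge0$ if there is an optimal $\tau^*$ of Bob such that for every $\sigma$, the cycle $C$ reachable from $s$ in $G(\sigma,\tau^*)$ satisfies $w(C)<0\Rightarrow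 w(C)/|C|\le -D$; $P_{G,w}(s)$ is the supremum of such $D$. For an integer $B>0$, the rounded weight function is $w_B(u,v)=\lceil w(u,v)/B\rceil\cdot B$. -}

module Defs where

open import Data.Nat as ℕ using (ℕ; zero; suc; NonZero)
open import Data.Integer as ℤ using (ℤ; +_; 0ℤ; -_; _/ℕ_)
open import Data.Fin using (Fin)
open import Data.Bool using (Bool; true)
open import Data.Product using (Σ; ∃; ∃-syntax; _×_; _,_)
open import Data.Sum using (_⊎_)
open import Relation.Nullary using (¬_)
open import Relation.Binary.PropositionalEquality using (_≡_; _≢_)

data ℕ∞ : Set where
  fin : ℕ → ℕ∞
  ∞   : ℕ∞

data _≤∞_ : ℕ∞ → ℕ∞ → Set where
  fin≤fin : ∀ {m n} → m ℕ.≤ n → fin m ≤∞ fin n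
  _≤∞∞    : ∀ x → x ≤∞ ∞

_+∞_ : ℕ∞ → ℕ → ℕ∞
fin m +∞ k = fin (m ℕ.+ k)
∞     +∞ k = ∞

data Player : Set where
  alice bob : Player

record GameGraph (n : ℕ) : Set where
  field
    edge   : Fin n → Fin n → Bool
    owner  : Fin n → Player
    outdeg : ∀ u → ∃[ v ] edge u v ≡ true
open GameGraph public

-- weight functions (only the values on edges are relevant)
Weight : ℕ → Set
Weight n = Fin n → Fin n → ℤ

-- positional strategies; values at nodes of the other player are irrelevant
AliceStrategy : ∀ {n} → GameGraph n → Set
AliceStrategy {n} G =
  Σ (Fin n → Fin n) λ σ → ∀ u → owner G u ≡ alice → edge G u (σ u) ≡ true

BobStrategy : ∀ {n} → GameGraph n → Set
BobStrategy {n} G =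
  Σ (Fin n → Fin n) λ τ → ∀ u → owner G u ≡ bob → edge G u (τ u) ≡ true

-- the successor function of G(σ,τ)
play : ∀ {n} (G : GameGraph n) → AliceStrategy G → BobStrategy G → Fin n → Fin n
play G (σ , _) (τ , _) u with owner G u
... | alice = σ u
... | bob   = τ u

iter : ∀ {n} → (Fin n → Fin n) → ℕ → Fin n → Fin n
iter f zero    s = s
iter f (suc k) s = iter f k (f s)

pathWeight : ∀ {n} → (Fin n → Fin n) → Weight n → Fin n → ℕ → ℤ
pathWeight f w s zero    = 0ℤ
pathWeight f w s (suc k) = w s (f s) ℤ.+ pathWeight f w (f s) k

SimplePath : ∀ {n} → (Fin n → Fin n) → Fin n → ℕ → Set
SimplePath f s k = ∀ i j → i ℕ.≤ k → j ℕ.≤ k → iter f i s ≡ iter f j s → i ≡ j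

ReachCycle : ∀ {n} → (Fin n → Fin n) → Fin n → Fin n → ℕ → Set
ReachCycle f s x p =
  (∃[ k ] iter f k s ≡ x) × 1 ℕ.≤ p × iter f p x ≡ x ×
  (∀ i → 0 ℕ.< i → i ℕ.< p → iter f i x ≢ x)

NegCycle : ∀ {n} → (Fin n → Fin n) → Weight n → Fin n → Set
NegCycle f w s = ∃[ x ] ∃[ p ] ReachCycle f s x p × pathWeight f w x p ℤ.< 0ℤ

-- e*_{G(σ,τ),w}(s) = e   (as a relation; f is the successor function of G(σ,τ))
data PlayEnergy {n} (f : Fin n → Fin n) (w : Weight n) (s : Fin n) : ℕ∞ → Set where
  infinite : NegCycle f w s → PlayEnergy f w s ∞
  finite   : ∀ e → ¬ NegCycle f w s →
             -- e = max {0, - min_P w(P)} over simple paths P from s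
             (∀ k → SimplePath f s k → - pathWeight f w s k ℤ.≤ + e) →
             (e ≡ 0 ⊎ ∃[ k ] (SimplePath f s k × pathWeight f w s k ≡ - (+ e))) →
             PlayEnergy f w s (fin e)

-- Minimal energy e*_{G,w}(s) = min_σ max_τ e*_{G(σ,τ),w}(s) = x
-- (min/max over the finitely many positional strategies, hence attained)

MinEnergy : ∀ {n} → GameGraph n → Weight n → Fin n → ℕ∞ → Set
MinEnergy G w s x =
  (∃[ σ ] ∀ τ e → PlayEnergy (play G σ τ) w s e → e ≤∞ x) ×
  (∀ σ → ∃[ τ ] ∀ e → PlayEnergy (play G σ τ) w s e → x ≤∞ e)

OptimalBob : ∀ {n} (G : GameGraph n) → Weight n → Fin n → BobStrategy G → Set
OptimalBob G w s τ* =
  ∀ x → MinEnergy G w s x →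
  ∀ σ e → PlayEnergy (play G σ τ*) w s e → x ≤∞ e

-- s has penalty at least D = p/q  (q ≥ 1):  some optimal τ* such that for every σ
-- the reachable cycle C with w(C) < 0 satisfies w(C)/|C| ≤ -p/q
HasPenalty : ∀ {n} → GameGraph n → Weight n → Fin n → (p q : ℕ) → Set
HasPenalty G w s p q =
  ∃[ τ* ] OptimalBob G w s τ* ×
    (∀ σ x l → ReachCycle (play G σ τ*) s x l →
       pathWeight (play G σ τ*) w x l ℤ.< 0ℤ →
       pathWeight (play G σ τ*) w x l ℤ.* + q ℤ.≤ - (+ (p ℕ.* l)))

-- P_{G,w}(s) ≥ B  (supremum): every nonnegative rational D = p/q < B is a penalty
PenaltyAtLeast : ∀ {n} → GameGraph n → Weight n → Fin n → ℕ → Set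
PenaltyAtLeast G w s B =
  ∀ p q → 1 ℕ.≤ q → p ℕ.< B ℕ.* q → HasPenalty G w s p q

-- Rounded weights w_B(u,v) = ⌈w(u,v)/B⌉·B  (B > 0; B = 0 is never used)

ceilDiv : ℤ → (B : ℕ) → .{{NonZero B}} → ℤ
ceilDiv a B = - ((- a) /ℕ B)

roundW : ∀ {n} → ℕ → Weight n → Weight n
roundW zero    w = w
roundW (suc b) w u v = ceilDiv (w u v) (suc b) ℤ.* + suc b

-- Write B = b + 1.  Rounding adds at most b to each edge weight, hence at most k·b
-- to a path with k edges.  For one play G(σ,τ) this gives:
--   * rounding never creates a negative cycle, and never increases the energy;
--   * if every negative cycle has mean ≤ -p/q with p/q > b, rounding keeps it
--     negative, and since the energy is realised on a simple path (< n edges)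
--     the energy grows by at most n·b.
-- To talk about "the" energy of a play we first show that it exists: negative
-- cycles and simple paths are decidable by bounded search in the functional
-- graph, and the energy is a bounded maximum.  The game-level inequalities then
-- follow by letting the relevant optimal strategies play against each other:
-- Alice's w-optimal σ against Bob's rounded reply for the lower bound, and
-- Alice's rounded-optimal σ against Bob's penalty strategy (p/q = (2b+1)/2 < B)
-- for the upper bound.  Finally n·(c/n) ≤ c.
module Submission where

open import Defs
open import Data.Nat using (ℕ; NonZero; _≤_; _*_; _/_)
open import Data.Fin using (Fin)
open import Data.Product using (_×_)
open import Data.Nat using (>-nonZero; zero; suc; _+_; _∸_; _<_; _≤?_; _<?_; z≤n; s≤s; anyUpTo?; allUpTo?)
import Data.Nat.Properties as ℕₚ
open import Data.Nat.DivMod using (m/n*n≤m; m≥n⇒m/n>0)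
open import Data.Nat.Induction using (<-rec)
open import Data.Integer as ℤ using (ℤ; +_; -_; 0ℤ; +≤+; +<+)
import Data.Integer.Properties as ℤₚ
open import Data.Integer.DivMod using (_/ℕ_; _%ℕ_; n%ℕd<d; a≡a%ℕn+[a/ℕn]*n)
open import Data.Integer.Tactic.RingSolver using (solve-∀)
import Data.Fin as Fin
import Data.Fin.Properties as Finₚ
open import Data.Product using (∃-syntax; _,_; proj₁; proj₂)
open import Data.Sum using (_⊎_; inj₁; inj₂)
open import Data.Empty using (⊥-elim)
open import Relation.Nullary using (Dec; yes; no)
open import Relation.Nullary.Decidable using (_×-dec_; _→-dec_; ¬?; map′)
open import Relation.Binary.PropositionalEquality

module FunctionalGraph {n : ℕ} (f : Fin n → Fin n) where

  iter-+ : ∀ a b s → iter f (a + b) s ≡ iter f b (iter f a s)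
  iter-+ zero    b s = refl
  iter-+ (suc a) b s = iter-+ a b (f s)

  orbit-collision : ∀ s → ∃[ i ] ∃[ j ] (i < j × j ≤ n × iter f i s ≡ iter f j s)
  orbit-collision s with Finₚ.pigeonhole (ℕₚ.n<1+n n) (λ i → iter f (Fin.toℕ i) s)
  ... | i , j , i<j , eq = Fin.toℕ i , Fin.toℕ j , i<j , ℕₚ.≤-pred (Finₚ.toℕ<n j) , eq

  shortcut : ∀ {s j} i k → iter f i s ≡ iter f j s → j ≤ k →
             iter f (i + (k ∸ j)) s ≡ iter f k s
  shortcut {s} {j} i k eq j≤k = begin
    iter f (i + (k ∸ j)) s      ≡⟨ iter-+ i (k ∸ j) s ⟩
    iter f (k ∸ j) (iter f i s) ≡⟨ cong (iter f (k ∸ j)) eq ⟩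
    iter f (k ∸ j) (iter f j s) ≡⟨ iter-+ j (k ∸ j) s ⟨
    iter f (j + (k ∸ j)) s      ≡⟨ cong (λ t → iter f t s) (ℕₚ.m+[n∸m]≡n j≤k) ⟩
    iter f k s                  ∎
    where open ≡-Reasoning

  shortcut-< : ∀ {i j} k → i < j → j ≤ k → i + (k ∸ j) < k
  shortcut-< {i} {j} k i<j j≤k = ℕₚ.<-≤-trans (ℕₚ.+-monoˡ-< (k ∸ j) i<j)
                                               (ℕₚ.≤-reflexive (ℕₚ.m+[n∸m]≡n j≤k))

  cycle-length-≤ : ∀ x p → iter f p x ≡ x → (∀ i → 0 < i → i < p → iter f i x ≢ x) → p ≤ n
  cycle-length-≤ x p back first with p ≤? n
  ... | yes p≤n = p≤n
  ... | no  p≰n with orbit-collision x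
  ... | i , j , i<j , j≤n , eq = ⊥-elim (first (i + (p ∸ j)) 0<i′ i′<p (trans (shortcut i p eq j≤p) back))
    where
      j<p : j < p
      j<p = ℕₚ.≤-<-trans j≤n (ℕₚ.≰⇒> p≰n)
      j≤p : j ≤ p
      j≤p = ℕₚ.<⇒≤ j<p
      i′<p : i + (p ∸ j) < p
      i′<p = shortcut-< p i<j j≤p
      0<i′ : 0 < i + (p ∸ j)
      0<i′ = ℕₚ.<-≤-trans (ℕₚ.m<n⇒0<n∸m j<p) (ℕₚ.m≤n+m (p ∸ j) i)

  reach-within : ∀ s x k → iter f k s ≡ x → ∃[ k′ ] (k′ ≤ n × iter f k′ s ≡ x)
  reach-within s x = <-rec (λ k → iter f k s ≡ x → ∃[ k′ ] (k′ ≤ n × iter f k′ s ≡ x)) step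
    where
      step : ∀ k → (∀ {m} → m < k → iter f m s ≡ x → ∃[ k′ ] (k′ ≤ n × iter f k′ s ≡ x)) →
             iter f k s ≡ x → ∃[ k′ ] (k′ ≤ n × iter f k′ s ≡ x)
      step k rec hit with k ≤? n
      ... | yes k≤n = k , k≤n , hit
      ... | no  k≰n with orbit-collision s
      ... | i , j , i<j , j≤n , eq =
        rec (shortcut-< k i<j j≤k) (trans (shortcut i k eq j≤k) hit)
        where
          j≤k : j ≤ k
          j≤k = ℕₚ.≤-trans j≤n (ℕₚ.<⇒≤ (ℕₚ.≰⇒> k≰n))

  simple-length-< : ∀ s k → SimplePath f s k → k < n
  simple-length-< s k simple with k <? n
  ... | yes k<n = k<n
  ... | no  k≮n with orbit-collision s
  ... | i , j , i<j , j≤n , eq = ⊥-elim (ℕₚ.<-irrefl (simple i j i≤k j≤k eq) i<j)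
    where
      j≤k : j ≤ k
      j≤k = ℕₚ.≤-trans j≤n (ℕₚ.≮⇒≥ k≮n)
      i≤k : i ≤ k
      i≤k = ℕₚ.≤-trans (ℕₚ.<⇒≤ i<j) j≤k

record BoundedMax (P : ℕ → Set) (g : ℕ → ℤ) (N : ℕ) : Set where
  field
    value    : ℕ
    bound    : ∀ {k} → k < N → P k → g k ℤ.≤ + value
    attained : value ≡ 0 ⊎ ∃[ k ] (P k × g k ≡ + value)

above-natural : ∀ {e} z → + e ℤ.< z → ∃[ m ] (z ≡ + m × e ≤ m)
above-natural (+ m) (+<+ e<m) = m , refl , ℕₚ.<⇒≤ e<m

extend-bound : ∀ {P : ℕ → Set} {g : ℕ → ℤ} {N e} →
               (∀ {k} → k < N → P k → g k ℤ.≤ + e) → (P N → g N ℤ.≤ + e) →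
               ∀ {k} → k < suc N → P k → g k ℤ.≤ + e
extend-bound below at k<1+N with ℕₚ.m<1+n⇒m<n∨m≡n k<1+N
... | inj₁ k<N  = below k<N
... | inj₂ refl = at

boundedMax : ∀ {P : ℕ → Set} → (∀ k → Dec (P k)) → ∀ g N → BoundedMax P g N
boundedMax P? g zero = record { value = 0 ; bound = λ () ; attained = inj₁ refl }
boundedMax P? g (suc N) with boundedMax P? g N
... | record { value = e ; bound = below ; attained = att } with P? N
...   | no ¬PN =
  record { value = e ; bound = extend-bound below (λ PN → ⊥-elim (¬PN PN)) ; attained = att }
...   | yes PN with g N ℤ.≤? + e
...     | yes gN≤e =
  record { value = e ; bound = extend-bound below (λ _ → gN≤e) ; attained = att }
...     | no  gN≰e with above-natural (g N) (ℤₚ.≰⇒> gN≰e)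
...       | m , gN≡m , e≤m = record
  { value    = m
  ; bound    = extend-bound (λ k<N Pk → ℤₚ.≤-trans (below k<N Pk) (+≤+ e≤m)) (λ _ → ℤₚ.≤-reflexive gN≡m)
  ; attained = inj₂ (N , PN , gN≡m)
  }

neg-swap : ∀ {a b : ℤ} → a ≡ - b → b ≡ - a
neg-swap {a} {b} eq = trans (sym (ℤₚ.neg-involutive b)) (cong -_ (sym eq))

module PlayAnalysis {n : ℕ} (f : Fin n → Fin n) (w : Weight n) (s : Fin n) where
  open FunctionalGraph f

  NegCycleAt : ℕ → ℕ → Set
  NegCycleAt k p = 1 ≤ p × iter f p x ≡ x × (∀ {i} → i < p → 0 < i → iter f i x ≢ x) ×
                   pathWeight f w x p ℤ.< 0ℤ
    where
      x : Fin n
      x = iter f k s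

  negCycleAt? : ∀ k p → Dec (NegCycleAt k p)
  negCycleAt? k p =
    (1 ≤? p) ×-dec (iter f p x Fin.≟ x) ×-dec
    allUpTo? (λ i → (0 <? i) →-dec ¬? (iter f i x Fin.≟ x)) p ×-dec
    (pathWeight f w x p ℤ.<? 0ℤ)
    where
      x : Fin n
      x = iter f k s

  -- By the bounds on reachability and cycle length, a negative cycle is found
  -- among the finitely many candidates k, p ≤ n.
  NegCycleWithin : Set
  NegCycleWithin = ∃[ k ] (k < suc n × ∃[ p ] (p < suc n × NegCycleAt k p))

  negCycle⇒within : NegCycle f w s → NegCycleWithin
  negCycle⇒within (x , p , ((k , hit) , 1≤p , back , first) , negative)
    with reach-within s x k hit
  ... | k′ , k′≤n , refl =
    k′ , s≤s k′≤n , p , s≤s (cycle-length-≤ x p back first) ,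
    1≤p , back , (λ i<p 0<i → first _ 0<i i<p) , negative

  within⇒negCycle : NegCycleWithin → NegCycle f w s
  within⇒negCycle (k , _ , p , _ , 1≤p , back , first , negative) =
    iter f k s , p , ((k , refl) , 1≤p , back , (λ i 0<i i<p → first i<p 0<i)) , negative

  negCycle? : Dec (NegCycle f w s)
  negCycle? = map′ within⇒negCycle negCycle⇒within
    (anyUpTo? (λ k → anyUpTo? (negCycleAt? k) (suc n)) (suc n))

  simplePath? : ∀ k → Dec (SimplePath f s k)
  simplePath? k = map′ to from
    (allUpTo? (λ i → allUpTo? (λ j → (iter f i s Fin.≟ iter f j s) →-dec (i ℕₚ.≟ j)) (suc k)) (suc k))
    where
      Bounded : Set
      Bounded = ∀ {i} → i < suc k → ∀ {j} → j < suc k → iter f i s ≡ iter f j s → i ≡ j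
      to : Bounded → SimplePath f s k
      to h i j i≤k j≤k = h (s≤s i≤k) (s≤s j≤k)
      from : SimplePath f s k → Bounded
      from h i<1+k j<1+k = h _ _ (ℕₚ.≤-pred i<1+k) (ℕₚ.≤-pred j<1+k)

  playEnergy : ∃[ e ] PlayEnergy f w s e
  playEnergy with negCycle?
  ... | yes neg = ∞ , infinite neg
  ... | no ¬neg = fin value , finite value ¬neg
                    (λ k simple → bound (simple-length-< s k simple) simple) (witness attained)
    where
      open BoundedMax (boundedMax simplePath? (λ k → - pathWeight f w s k) n)
      witness : value ≡ 0 ⊎ ∃[ k ] (SimplePath f s k × - pathWeight f w s k ≡ + value) →
                value ≡ 0 ⊎ ∃[ k ] (SimplePath f s k × pathWeight f w s k ≡ - (+ value))
      witness (inj₁ zero-energy)        = inj₁ zero-energy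
      witness (inj₂ (k , simple , eq)) = inj₂ (k , simple , neg-swap (sym eq))

round-up-edge : ∀ {n} b (w : Weight n) u v →
                ∃[ r ] (r ≤ b × roundW (suc b) w u v ≡ w u v ℤ.+ + r)
round-up-edge b w u v = r , ℕₚ.≤-pred (n%ℕd<d (- a) (suc b)) , (begin
    - q ℤ.* + suc b                   ≡⟨ negated-division q (+ suc b) (+ r) ⟩
    - (+ r ℤ.+ q ℤ.* + suc b) ℤ.+ + r ≡⟨ cong (λ t → - t ℤ.+ + r) (a≡a%ℕn+[a/ℕn]*n (- a) (suc b)) ⟨
    - - a ℤ.+ + r                     ≡⟨ cong (ℤ._+ + r) (ℤₚ.neg-involutive a) ⟩
    a ℤ.+ + r                         ∎)
  where
    open ≡-Reasoning
    a q : ℤ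
    a = w u v
    q = (- a) /ℕ suc b
    r : ℕ
    r = (- a) %ℕ suc b
    negated-division : ∀ q B r → - q ℤ.* B ≡ - (r ℤ.+ q ℤ.* B) ℤ.+ r
    negated-division = solve-∀

round-up-path : ∀ {n} b (w : Weight n) (f : Fin n → Fin n) x k →
                ∃[ d ] (d ≤ k * b × pathWeight f (roundW (suc b) w) x k ≡ pathWeight f w x k ℤ.+ + d)
round-up-path b w f x zero = 0 , z≤n , refl
round-up-path b w f x (suc k) with round-up-edge b w x (f x) | round-up-path b w f (f x) k
... | r , r≤b , edge | d , d≤kb , rest = r + d , ℕₚ.+-mono-≤ r≤b d≤kb , (begin
    pathWeight f (roundW (suc b) w) x (suc k)           ≡⟨ cong₂ ℤ._+_ edge rest ⟩
    (w x (f x) ℤ.+ + r) ℤ.+ (pathWeight f w (f x) k ℤ.+ + d)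
      ≡⟨ interchange (w x (f x)) (+ r) (pathWeight f w (f x) k) (+ d) ⟩
    pathWeight f w x (suc k) ℤ.+ (+ r ℤ.+ + d)          ≡⟨ cong (λ t → pathWeight f w x (suc k) ℤ.+ t) (ℤₚ.pos-+ r d) ⟨
    pathWeight f w x (suc k) ℤ.+ + (r + d)              ∎)
  where
    open ≡-Reasoning
    interchange : ∀ a b c d → (a ℤ.+ b) ℤ.+ (c ℤ.+ d) ≡ (a ℤ.+ c) ℤ.+ (b ℤ.+ d)
    interchange = solve-∀

pathWeight-≤-rounded : ∀ {n} b (w : Weight n) (f : Fin n → Fin n) x k →
                       pathWeight f w x k ℤ.≤ pathWeight f (roundW (suc b) w) x k
pathWeight-≤-rounded b w f x k with round-up-path b w f x k
... | d , _ , eq = ℤₚ.≤-trans (ℤₚ.i≤i+j _ (+ d)) (ℤₚ.≤-reflexive (sym eq))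

steep-stays-negative : ∀ {p q l b d} (P : ℤ) → b * q < p → 1 ≤ l → d ≤ l * b →
                       P ℤ.* + q ℤ.≤ - (+ (p * l)) → P ℤ.+ + d ℤ.< 0ℤ
steep-stays-negative {p} {q} {l} {b} {d} P bq<p 1≤l d≤lb Pq≤-pl =
  unscale (ℤₚ.≤-<-trans scaled (ℤₚ.neg-mono-< (+<+ (ℕₚ.m<n⇒0<n∸m dq<pl))))
  where
    dq<pl : d * q < p * l
    dq<pl = ℕₚ.≤-<-trans (ℕₚ.*-monoˡ-≤ q d≤lb) (begin-strict
      l * b * q   ≡⟨ ℕₚ.*-assoc l b q ⟩
      l * (b * q) <⟨ ℕₚ.*-monoʳ-< l {{>-nonZero 1≤l}} bq<p ⟩
      l * p       ≡⟨ ℕₚ.*-comm l p ⟩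
      p * l       ∎)
      where open ℕₚ.≤-Reasoning
    scaled : (P ℤ.+ + d) ℤ.* + q ℤ.≤ - (+ (p * l ∸ d * q))
    scaled = begin
      (P ℤ.+ + d) ℤ.* + q       ≡⟨ ℤₚ.*-distribʳ-+ (+ q) P (+ d) ⟩
      P ℤ.* + q ℤ.+ + d ℤ.* + q ≡⟨ cong (λ t → P ℤ.* + q ℤ.+ t) (ℤₚ.pos-* d q) ⟨
      P ℤ.* + q ℤ.+ + (d * q)   ≤⟨ ℤₚ.+-monoˡ-≤ (+ (d * q)) Pq≤-pl ⟩
      - (+ (p * l)) ℤ.+ + (d * q) ≡⟨ ℤₚ.-m+n≡n⊖m (p * l) (d * q) ⟩
      d * q ℤ.⊖ p * l           ≡⟨ ℤₚ.⊖-< dq<pl ⟩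
      - (+ (p * l ∸ d * q))     ∎
      where open ℤₚ.≤-Reasoning
    unscale : ∀ {Q} → Q ℤ.* + q ℤ.< 0ℤ → Q ℤ.< 0ℤ
    unscale {Q} Qq<0 with Q ℤ.<? 0ℤ
    ... | yes Q<0 = Q<0
    ... | no  Q≮0 = ⊥-elim (ℤₚ.<⇒≱ Qq<0 (ℤₚ.*-monoʳ-≤-nonNeg (+ q) {0ℤ} {Q} (ℤₚ.≮⇒≥ Q≮0)))

-- Every negative cycle reachable from s has mean weight at most -p/q
-- (this is the cycle condition in HasPenalty, for one play).
SteepCycles : ∀ {n} → (Fin n → Fin n) → Weight n → Fin n → ℕ → ℕ → Set
SteepCycles f w s p q = ∀ x l → ReachCycle f s x l → pathWeight f w x l ℤ.< 0ℤ →
                        pathWeight f w x l ℤ.* + q ℤ.≤ - (+ (p * l))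

module RoundedPlay {n : ℕ} (b : ℕ) (w : Weight n) where

  wB : Weight n
  wB = roundW (suc b) w

  module _ (f : Fin n → Fin n) (s : Fin n) where
    open FunctionalGraph f

    negCycle-unrounded : NegCycle f wB s → NegCycle f w s
    negCycle-unrounded (x , p , cycle , negative) =
      x , p , cycle , ℤₚ.≤-<-trans (pathWeight-≤-rounded b w f x p) negative

    negCycle-rounded : ∀ {p q} → b * q < p → SteepCycles f w s p q → NegCycle f w s → NegCycle f wB s
    negCycle-rounded bq<p steep (x , l , cycle , negative) with round-up-path b w f x l
    ... | d , d≤lb , eq = x , l , cycle ,
      ℤₚ.≤-<-trans (ℤₚ.≤-reflexive eq)
        (steep-stays-negative (pathWeight f w x l) bq<p (proj₁ (proj₂ cycle)) d≤lb (steep x l cycle negative))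

    energy-rounded-≤ : ∀ {eB e} → PlayEnergy f wB s eB → PlayEnergy f w s e → eB ≤∞ e
    energy-rounded-≤ {eB} _ (infinite _) = eB ≤∞∞
    energy-rounded-≤ (infinite neg) (finite _ ¬neg _ _) = ⊥-elim (¬neg (negCycle-unrounded neg))
    energy-rounded-≤ (finite _ _ _ (inj₁ refl)) (finite _ _ _ _) = fin≤fin z≤n
    energy-rounded-≤ (finite eB _ _ (inj₂ (k , simple , eq))) (finite e _ bound _) =
      fin≤fin (ℤₚ.drop‿+≤+ (begin
        + eB                          ≡⟨ neg-swap eq ⟩
        - pathWeight f wB s k         ≤⟨ ℤₚ.neg-mono-≤ (pathWeight-≤-rounded b w f s k) ⟩
        - pathWeight f w s k          ≤⟨ bound k simple ⟩
        + e                           ∎))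
      where open ℤₚ.≤-Reasoning

    -- With steep cycles it increases the energy by at most n·b: the path realising
    -- the energy is simple, so it has fewer than n edges, each rounded by at most b.
    energy-≤-rounded : ∀ {p q eB e} → b * q < p → SteepCycles f w s p q →
                       PlayEnergy f w s e → PlayEnergy f wB s eB → e ≤∞ (eB +∞ (n * b))
    energy-≤-rounded {e = e} _ _ _ (infinite _) = e ≤∞∞
    energy-≤-rounded bq<p steep (infinite neg) (finite _ ¬neg _ _) =
      ⊥-elim (¬neg (negCycle-rounded bq<p steep neg))
    energy-≤-rounded _ _ (finite _ _ _ (inj₁ refl)) (finite _ _ _ _) = fin≤fin z≤n
    energy-≤-rounded _ _ (finite e _ _ (inj₂ (k , simple , eq))) (finite eB _ bound _)
      with round-up-path b w f s k
    ... | d , d≤kb , eqd = fin≤fin (ℕₚ.≤-trans (ℤₚ.drop‿+≤+ e≤eB+d) (ℕₚ.+-monoʳ-≤ eB d≤nb))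
      where
        P : ℤ
        P = pathWeight f w s k
        d≤nb : d ≤ n * b
        d≤nb = ℕₚ.≤-trans d≤kb (ℕₚ.*-monoˡ-≤ b (ℕₚ.<⇒≤ (simple-length-< s k simple)))
        e≤eB+d : + e ℤ.≤ + (eB + d)
        e≤eB+d = begin
          + e                           ≡⟨ neg-swap eq ⟩
          - P                           ≡⟨ cancel P (+ d) ⟩
          - (P ℤ.+ + d) ℤ.+ + d         ≡⟨ cong (λ t → - t ℤ.+ + d) eqd ⟨
          - pathWeight f wB s k ℤ.+ + d ≤⟨ ℤₚ.+-monoˡ-≤ (+ d) (bound k simple) ⟩
          + eB ℤ.+ + d                  ≡⟨ ℤₚ.pos-+ eB d ⟨
          + (eB + d)                    ∎
          where
            open ℤₚ.≤-Reasoning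
            cancel : ∀ P D → - P ≡ - (P ℤ.+ D) ℤ.+ D
            cancel = solve-∀

≤∞-trans : ∀ {a b c} → a ≤∞ b → b ≤∞ c → a ≤∞ c
≤∞-trans _            (_ ≤∞∞)      = _ ≤∞∞
≤∞-trans (fin≤fin a≤b) (fin≤fin b≤c) = fin≤fin (ℕₚ.≤-trans a≤b b≤c)

+∞-monoˡ : ∀ {a b} k → a ≤∞ b → (a +∞ k) ≤∞ (b +∞ k)
+∞-monoˡ k (fin≤fin a≤b) = fin≤fin (ℕₚ.+-monoˡ-≤ k a≤b)
+∞-monoˡ k (a ≤∞∞)       = (a +∞ k) ≤∞∞

+∞-monoʳ : ∀ a {k k′} → k ≤ k′ → (a +∞ k) ≤∞ (a +∞ k′)
+∞-monoʳ (fin m) k≤k′ = fin≤fin (ℕₚ.+-monoʳ-≤ m k≤k′)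
+∞-monoʳ ∞       _    = ∞ ≤∞∞

module RoundedGame {n : ℕ} (G : GameGraph n) (w : Weight n) (b : ℕ) (v : Fin n) where
  open RoundedPlay b w using (wB; energy-rounded-≤; energy-≤-rounded)

  energyOf : ∀ σ τ (u : Weight n) → ∃[ e ] PlayEnergy (play G σ τ) u v e
  energyOf σ τ u = PlayAnalysis.playEnergy (play G σ τ) u v

  -- e*_{G,w_B}(v) ≤ e*_{G,w}(v): play Alice's w-optimal σ against Bob's best
  -- reply τ in the rounded game; rounding only lowers the energy of G(σ,τ).
  minEnergy-rounded-≤ : ∀ {x y} → MinEnergy G w v x → MinEnergy G wB v y → y ≤∞ x
  minEnergy-rounded-≤ ((σ , σ-secures) , _) (_ , replies) with replies σ
  ... | τ , τ-forces =
    let (eB , peB) = energyOf σ τ wB ; (e , pe) = energyOf σ τ w in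
    ≤∞-trans (τ-forces eB peB)
      (≤∞-trans (energy-rounded-≤ (play G σ τ) v peB pe) (σ-secures τ e pe))

  -- e*_{G,w}(v) ≤ e*_{G,w_B}(v) + n·b when v has penalty p/q > b: play Alice's
  -- w_B-optimal σ against Bob's penalty strategy τ*, whose cycles are steep.
  minEnergy-≤-rounded : ∀ {p q x y} → b * q < p → HasPenalty G w v p q →
                        MinEnergy G w v x → MinEnergy G wB v y → x ≤∞ (y +∞ (n * b))
  minEnergy-≤-rounded bq<p (τ* , optimal , steep) x-min ((σ , σ-secures) , _) =
    let (eB , peB) = energyOf σ τ* wB ; (e , pe) = energyOf σ τ* w in
    ≤∞-trans (optimal _ x-min σ e pe)
      (≤∞-trans (energy-≤-rounded (play G σ τ*) v bq<p (steep σ) pe peB)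
                (+∞-monoˡ (n * b) (σ-secures τ* eB peB)))

-- With B = c / n = b + 1 (positive as n ≤ c), the penalty p/q = (2b+1)/2 < B
-- exceeds b, so the two comparisons above apply; finally n·B ≤ c.
proposition9 : ∀ {n} .{{_ : NonZero n}} (G : GameGraph n) (w : Weight n)
    (c : ℕ) → n ≤ c → (v : Fin n) →
    PenaltyAtLeast G w v (c / n) →
    ∀ x y → MinEnergy G w v x → MinEnergy G (roundW (c / n) w) v y →
    (y ≤∞ x) × (x ≤∞ (y +∞ (n * (c / n)))) × ((y +∞ (n * (c / n))) ≤∞ (y +∞ c))
proposition9 {n} G w c n≤c v penalty x y x-min y-min
  with c / n | m≥n⇒m/n>0 {c} {n} n≤c | subst (_≤ c) (ℕₚ.*-comm (c / n) n) (m/n*n≤m c n)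
... | zero  | () | _
... | suc b | _  | nB≤c =
    minEnergy-rounded-≤ x-min y-min
  , ≤∞-trans (minEnergy-≤-rounded (ℕₚ.n<1+n (b * 2)) steep-penalty x-min y-min)
             (+∞-monoʳ y (ℕₚ.*-monoʳ-≤ n (ℕₚ.n≤1+n b)))
  , +∞-monoʳ y nB≤c
  where
    open RoundedGame G w b v
    steep-penalty : HasPenalty G w v (suc (b * 2)) 2
    steep-penalty = penalty (suc (b * 2)) 2 (s≤s z≤n) (ℕₚ.n<1+n (suc (b * 2)))
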